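{- For any positive integers $r,t\ge 3$, $\dim_s(K_r\times K_t)=\max\{r(t-1),\ t(r-1)\}$.
   Context: $K_n$ is the complete graph of order $n$. The direct product $G\times H$ has vertex set $V(G)\times V(H)$, with $(a,b)\sim(c,d)$ iff $ac\in E(G)$ and $bd\in E(H)$. For a connected graph $G$, $I_G[u,v]$ is the set of vertices on some shortest $u$–$v$ path. A vertex $w$ strongly resolves $u,v$ if $v\in I_G[u,w]$ or $u\in I_G[v,w]$. A strong resolving set is a set $S\subseteq V(G)$ such that every pair of vertices is strongly resolved by some vertex of $S$; $\dim_s(G)$ is the minimum cardinality of a strong resolving set. -}

module Defs where

open import Data.Nat using (ℕ; zero; suc; _+_; _<_; _≤_)
open import Data.Fin using (Fin)
open import Data.Product using (Σ; _×_; _,_; ∃-syntax)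
open import Data.Sum using (_⊎_)
open import Data.List using (List; length)
open import Data.List.Membership.Propositional using (_∈_)
open import Data.List.Relation.Unary.Unique.Propositional using (Unique)
open import Relation.Binary.PropositionalEquality using (_≡_; _≢_)
open import Relation.Nullary using (¬_)

record Graph : Set₁ where
  field
    V   : Set
    Adj : V → V → Set

open Graph public

K : ℕ → Graph
K n = record { V = Fin n ; Adj = λ i j → i ≢ j }

_×ᴳ_ : Graph → Graph → Graph
G ×ᴳ H = record
  { V   = V G × V H
  ; Adj = λ { (a , b) (c , d) → Adj G a c × Adj H b d } }

data Walk (G : Graph) : V G → V G → ℕ → Set where
  here : ∀ {u} → Walk G u u zero
  step : ∀ {u w v k} → Adj G u w → Walk G w v k → Walk G u v (suc k)

Connected : Graph → Set
Connected G = ∀ (u v : V G) → ∃[ k ] Walk G u v k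

Dist : (G : Graph) → V G → V G → ℕ → Set
Dist G u v d = Walk G u v d × (∀ k → Walk G u v k → d ≤ k)

-- Interval I_G[u,v]: w lies on some shortest u–v walk (= path).
InInterval : (G : Graph) → V G → V G → V G → Set
InInterval G w u v =
  ∃[ a ] ∃[ b ] (Walk G u w a × Walk G w v b × Dist G u v (a + b))

StronglyResolves : (G : Graph) → V G → V G → V G → Set
StronglyResolves G w u v = InInterval G v u w ⊎ InInterval G u v w

-- Strong resolving set (finite set given as a duplicate-free list).
IsStrongResolvingSet : (G : Graph) → List (V G) → Set
IsStrongResolvingSet G S =
  ∀ (u v : V G) → u ≢ v → ∃[ w ] (w ∈ S × StronglyResolves G w u v)

StrongMetricDim : Graph → ℕ → Set
StrongMetricDim G d =
  (∃[ S ] (Unique S × IsStrongResolvingSet G S × length S ≡ d))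
  × (∀ (S : List (V G)) → Unique S → IsStrongResolvingSet G S → d ≤ length S)

-- Any two vertices of K r × K t (r, t ≥ 3) are joined by a walk of length 2, so a
-- vertex w strongly resolving two non-adjacent vertices u, v must be u or v itself.
-- Two distinct vertices are non-adjacent exactly when they share a row or a column,
-- hence a strong resolving set misses at most one vertex per row and per column,
-- giving |S| ≥ r(t-1) and |S| ≥ t(r-1). Conversely, if the vertices outside S are
-- pairwise adjacent then S is strongly resolving: a pair outside S is resolved by a
-- vertex of S in the row of one of them and outside the columns of both. Taking
-- for the complement of S the graph of an injection Fin (min r t) → Fin (max r t)
-- attains the bound.
module Submission where

open import Defs
open import Data.Nat using (ℕ; zero; suc; _≤_; _*_; _∸_; _⊔_; z≤n; s≤s)
open import Data.Nat.Properties
  using (m+n≤o⇒n≤o; m≥n⇒m⊔n≡m; m≤n⇒m⊔n≡n; ⊔-lub; ≤-total; +-mono-≤; ≤-reflexive; *-comm; +-identityʳ)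
open import Data.Fin using (Fin; zero; suc; punchIn; punchOut; remQuot; combine; inject≤; _≟_)
open import Data.Fin.Properties
  using (punchIn-injective; punchInᵢ≢i; punchIn-punchOut; remQuot-combine; combine-remQuot; injective⇒≤; inject≤-injective; any?)
open import Data.Product using (∃-syntax; _×_; _,_; proj₁; proj₂; uncurry; swap)
open import Data.Product.Properties using (≡-dec)
open import Data.Sum using (_⊎_; inj₁; inj₂; [_,_]′)
import Data.Sum as Sum
open import Data.List using (List; length; map; allFin; lookup)
open import Data.List.Properties using (length-map; length-tabulate)
open import Data.List.Membership.Propositional using (_∈_; _∉_)
open import Data.List.Membership.Propositional.Properties using (∈-map⁺; ∈-allFin)
open import Data.List.Relation.Unary.Any using (index) renaming (any? to any-∈?)
open import Data.List.Relation.Unary.Any.Properties using (lookup-index)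
open import Data.List.Relation.Unary.Unique.Propositional using (Unique)
open import Data.List.Relation.Unary.Unique.Propositional.Properties using (map⁺; allFin⁺)
open import Function using (_∘_; id)
open import Function.Definitions using (Injective)
open import Relation.Binary.PropositionalEquality
open import Relation.Nullary using (¬_; Dec; yes; no; contradiction)
open import Relation.Nullary.Decidable using (¬?; decidable-stable; _×-dec_)
open import Relation.Unary using (Decidable)

StrongResolvingSetOfSize : (G : Graph) → ℕ → Set
StrongResolvingSetOfSize G d = ∃[ S ] (Unique S × IsStrongResolvingSet G S × length S ≡ d)

module _ {G : Graph} where

  dist-adjacent : ∀ {u v} → u ≢ v → Adj G u v → Dist G u v 1
  dist-adjacent {u} {v} u≢v uv = step uv here , minimal
    where
    minimal : ∀ k → Walk G u v k → 1 ≤ k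
    minimal zero    here = contradiction refl u≢v
    minimal (suc k) _    = s≤s z≤n

  dist-nonadjacent : ∀ {u v} → Walk G u v 2 → u ≢ v → ¬ Adj G u v → Dist G u v 2
  dist-nonadjacent {u} {v} walk u≢v ¬uv = walk , minimal
    where
    minimal : ∀ k → Walk G u v k → 2 ≤ k
    minimal zero          here           = contradiction refl u≢v
    minimal (suc zero)    (step uv here) = contradiction uv ¬uv
    minimal (suc (suc k)) _              = s≤s (s≤s z≤n)

  dist-exists : (∀ u v → Walk G u v 2) → (∀ u v → Dec (Adj G u v)) →
                ∀ u v → u ≢ v → ∃[ k ] Dist G u v k
  dist-exists walk₂ adj? u v u≢v with adj? u v
  ... | yes uv = 1 , dist-adjacent u≢v uv
  ... | no ¬uv = 2 , dist-nonadjacent (walk₂ u v) u≢v ¬uv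

  endpoint-in-interval : ∀ {u v k} → Dist G u v k → InInterval G v u v
  endpoint-in-interval {u} {v} {k} (walk , minimal) =
    k , 0 , walk , here , subst (Dist G u v) (sym (+-identityʳ k)) (walk , minimal)

  common-neighbour-in-interval : ∀ {u v w} → Adj G u v → Adj G v w → Dist G u w 2 →
                                 InInterval G v u w
  common-neighbour-in-interval uv vw d = 1 , 1 , step uv here , step vw here , d

  -- v is at distance at least 2 from u, while w is at distance at most 2.
  interval-of-nonadjacent : ∀ {u v w} → Walk G u w 2 → u ≢ v → ¬ Adj G u v →
                            InInterval G v u w → w ≡ v
  interval-of-nonadjacent _ u≢v _ (zero , _ , here , _) = contradiction refl u≢v
  interval-of-nonadjacent _ _ ¬uv (suc zero , _ , step uv here , _) = contradiction uv ¬uv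
  interval-of-nonadjacent _ _ _ (suc (suc _) , zero , _ , here , _) = refl
  interval-of-nonadjacent uw _ _ (suc (suc a) , suc b , _ , _ , _ , minimal)
    with minimal 2 uw
  ... | s≤s (s≤s 2+a+b≤0) with m+n≤o⇒n≤o a 2+a+b≤0
  ... | ()

  resolving-covers-nonadjacent :
    (∀ u v → Walk G u v 2) → (∀ {u v} → Adj G u v → Adj G v u) →
    ∀ {S} → IsStrongResolvingSet G S →
    ∀ {u v} → u ≢ v → ¬ Adj G u v → u ∈ S ⊎ v ∈ S
  resolving-covers-nonadjacent walk₂ adj-sym resolving {u} {v} u≢v ¬uv with resolving u v u≢v
  ... | w , w∈S , inj₁ v∈I[u,w] =
    inj₂ (subst (_∈ _) (interval-of-nonadjacent (walk₂ u w) u≢v ¬uv v∈I[u,w]) w∈S)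
  ... | w , w∈S , inj₂ u∈I[v,w] =
    inj₁ (subst (_∈ _) (interval-of-nonadjacent (walk₂ v w) (≢-sym u≢v) (¬uv ∘ adj-sym) u∈I[v,w]) w∈S)

fresh : ∀ {n} → 3 ≤ n → (a c : Fin n) → ∃[ e ] (e ≢ a × e ≢ c)
fresh (s≤s (s≤s (s≤s _))) zero          zero          = suc zero , (λ ()) , (λ ())
fresh (s≤s (s≤s (s≤s _))) zero          (suc zero)    = suc (suc zero) , (λ ()) , (λ ())
fresh (s≤s (s≤s (s≤s _))) zero          (suc (suc _)) = suc zero , (λ ()) , (λ ())
fresh (s≤s (s≤s (s≤s _))) (suc zero)    zero          = suc (suc zero) , (λ ()) , (λ ())
fresh (s≤s (s≤s (s≤s _))) (suc zero)    (suc _)       = zero , (λ ()) , (λ ())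
fresh (s≤s (s≤s (s≤s _))) (suc (suc _)) zero          = suc zero , (λ ()) , (λ ())
fresh (s≤s (s≤s (s≤s _))) (suc (suc _)) (suc _)       = zero , (λ ()) , (λ ())

_∈?_ : ∀ {m n} (x : Fin m × Fin n) (S : List (Fin m × Fin n)) → Dec (x ∈ S)
x ∈? S = any-∈? (≡-dec _≟_ _≟_ x) S

allButOne : ∀ {n} {P : Fin (suc n) → Set} → Decidable P →
            (∀ i j → i ≢ j → P i ⊎ P j) → ∃[ m ] (∀ i → i ≢ m → P i)
allButOne P? cover with any? (¬? ∘ P?)
... | yes (m , ¬Pm) = m , λ i i≢m → [ (λ Pm → contradiction Pm ¬Pm) , id ]′ (cover m i (≢-sym i≢m))
... | no ¬∃¬P       = zero , λ i _ → decidable-stable (P? i) (λ ¬Pi → ¬∃¬P (i , ¬Pi))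

module _ {r t : ℕ} where

  adjacent? : ∀ u v → Dec (Adj (K r ×ᴳ K t) u v)
  adjacent? (a , b) (c , d) = ¬? (a ≟ c) ×-dec ¬? (b ≟ d)

  adjacent-sym : ∀ {u v} → Adj (K r ×ᴳ K t) u v → Adj (K r ×ᴳ K t) v u
  adjacent-sym (a≢c , b≢d) = ≢-sym a≢c , ≢-sym b≢d

  walk₂ : 3 ≤ r → 3 ≤ t → ∀ u v → Walk (K r ×ᴳ K t) u v 2
  walk₂ hr ht (a , b) (c , d) with fresh hr a c | fresh ht b d
  ... | e , e≢a , e≢c | f , f≢b , f≢d =
    step (≢-sym e≢a , ≢-sym f≢b) (step (e≢c , f≢d) here)

  same-row-nonadjacent : ∀ {a b c} → ¬ Adj (K r ×ᴳ K t) (a , b) (a , c)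
  same-row-nonadjacent (a≢a , _) = a≢a refl

  same-column-nonadjacent : ∀ {a b c} → ¬ Adj (K r ×ᴳ K t) (a , b) (c , b)
  same-column-nonadjacent (_ , b≢b) = b≢b refl

  resolving-if-complement-clique :
    3 ≤ r → 3 ≤ t → (S : List (Fin r × Fin t)) →
    (∀ {u v} → u ∉ S → v ∉ S → u ≢ v → Adj (K r ×ᴳ K t) u v) →
    IsStrongResolvingSet (K r ×ᴳ K t) S
  resolving-if-complement-clique hr ht S clique u v u≢v with u ∈? S | v ∈? S
  ... | yes u∈S | _ =
    u , u∈S , inj₂ (endpoint-in-interval (proj₂ (dist-exists (walk₂ hr ht) adjacent? v u (≢-sym u≢v))))
  ... | no _ | yes v∈S =
    v , v∈S , inj₁ (endpoint-in-interval (proj₂ (dist-exists (walk₂ hr ht) adjacent? u v u≢v)))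
  resolving-if-complement-clique hr ht S clique (a , b) (c , d) u≢v | no u∉S | no v∉S
    with clique u∉S v∉S u≢v | fresh ht b d
  ... | a≢c , _ | e , e≢b , e≢d = (a , e) , w∈S , inj₁ v∈I[u,w]
    where
    u≢w : (a , b) ≢ (a , e)
    u≢w = e≢b ∘ sym ∘ cong proj₂
    w∈S : (a , e) ∈ S
    w∈S = decidable-stable ((a , e) ∈? S) (λ w∉S → same-row-nonadjacent (clique u∉S w∉S u≢w))
    v∈I[u,w] : InInterval (K r ×ᴳ K t) (c , d) (a , b) (a , e)
    v∈I[u,w] = common-neighbour-in-interval (clique u∉S v∉S u≢v) (≢-sym a≢c , ≢-sym e≢d)
                 (dist-nonadjacent (walk₂ hr ht _ _) u≢w same-row-nonadjacent)

  graph-adjacent : {ι : Fin r → Fin t} → Injective _≡_ _≡_ ι → ∀ {u v} → u ≢ v →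
                   proj₂ u ≡ ι (proj₁ u) → proj₂ v ≡ ι (proj₁ v) → Adj (K r ×ᴳ K t) u v
  graph-adjacent {ι} ι-inj {a , b} {c , d} u≢v b≡ιa d≡ιc = a≢c , b≢d
    where
    a≢c : a ≢ c
    a≢c a≡c = u≢v (cong₂ _,_ a≡c (trans b≡ιa (trans (cong ι a≡c) (sym d≡ιc))))
    b≢d : b ≢ d
    b≢d b≡d = a≢c (ι-inj (trans (sym b≡ιa) (trans b≡d d≡ιc)))

pairImage : ∀ {A : Set} {m n} → (Fin m × Fin n → A) → List A
pairImage {m = m} {n} f = map (f ∘ remQuot n) (allFin (m * n))

module _ {m n : ℕ} where

  remQuot-injective : Injective _≡_ _≡_ (remQuot {m} n)
  remQuot-injective {i} {j} eq = begin
    i                                ≡⟨ sym (combine-remQuot {m} n i) ⟩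
    uncurry combine (remQuot {m} n i) ≡⟨ cong (uncurry combine) eq ⟩
    uncurry combine (remQuot {m} n j) ≡⟨ combine-remQuot {m} n j ⟩
    j                                ∎
    where open ≡-Reasoning

  module _ {A : Set} (f : Fin m × Fin n → A) where

    length-pairImage : length (pairImage f) ≡ m * n
    length-pairImage = trans (length-map (f ∘ remQuot n) (allFin (m * n))) (length-tabulate id)

    pairImage-unique : Injective _≡_ _≡_ f → Unique (pairImage f)
    pairImage-unique f-inj = map⁺ (remQuot-injective ∘ f-inj) (allFin⁺ (m * n))

    ∈-pairImage : ∀ x → f x ∈ pairImage f
    ∈-pairImage (a , j) =
      subst (λ y → f y ∈ pairImage f) (remQuot-combine {m} {n} a j)
            (∈-map⁺ (f ∘ remQuot n) (∈-allFin (combine a j)))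

    *≤length : Injective _≡_ _≡_ f → {S : List A} → (∀ x → f x ∈ S) → m * n ≤ length S
    *≤length f-inj {S} f∈S =
      injective⇒≤ {f = λ k → index (f∈S (remQuot n k))} (remQuot-injective ∘ f-inj ∘ index-injective)
      where
      index-injective : ∀ {x y} {x∈S : x ∈ S} {y∈S : y ∈ S} → index x∈S ≡ index y∈S → x ≡ y
      index-injective {x∈S = x∈S} {y∈S} eq =
        trans (lookup-index x∈S) (trans (cong (lookup S) eq) (sym (lookup-index y∈S)))

punctured : ∀ {r n} → (Fin r → Fin (suc n)) → Fin r × Fin n → Fin r × Fin (suc n)
punctured m (a , j) = a , punchIn (m a) j

punctured-injective : ∀ {r n} (m : Fin r → Fin (suc n)) → Injective _≡_ _≡_ (punctured m)
punctured-injective m {a , j} {a′ , j′} eq with cong proj₁ eq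
... | refl = cong (a ,_) (punchIn-injective (m a) j j′ (cong proj₂ eq))

∉-punctured⇒graph : ∀ {r n} (m : Fin r → Fin (suc n)) x →
                    x ∉ pairImage (punctured m) → proj₂ x ≡ m (proj₁ x)
∉-punctured⇒graph m (a , b) ∉image with b ≟ m a
... | yes b≡ma = b≡ma
... | no b≢ma  = contradiction (subst (_∈ _) (cong (a ,_) (punchIn-punchOut (b≢ma ∘ sym)))
                                  (∈-pairImage (punctured m) (a , punchOut (b≢ma ∘ sym)))) ∉image

rowCover-≤ : ∀ {r n} (S : List (Fin r × Fin (suc n))) →
             (∀ a b c → b ≢ c → (a , b) ∈ S ⊎ (a , c) ∈ S) → r * n ≤ length S
rowCover-≤ {r} {n} S cover = *≤length (punctured missing) (punctured-injective missing) punctured∈S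
  where
  missing : Fin r → Fin (suc n)
  missing a = proj₁ (allButOne (λ b → (a , b) ∈? S) (cover a))
  punctured∈S : ∀ x → punctured missing x ∈ S
  punctured∈S (a , j) =
    proj₂ (allButOne (λ b → (a , b) ∈? S) (cover a)) (punchIn (missing a) j) (punchInᵢ≢i _ j)

strongResolving-≥ : ∀ {r t} → 3 ≤ suc r → 3 ≤ suc t →
                    {S : List (Fin (suc r) × Fin (suc t))} →
                    IsStrongResolvingSet (K (suc r) ×ᴳ K (suc t)) S →
                    suc r * t ⊔ suc t * r ≤ length S
strongResolving-≥ {r} {t} hr ht {S} resolving = ⊔-lub (rowCover-≤ S rows) columns
  where
  covers : ∀ {u v} → u ≢ v → ¬ Adj (K (suc r) ×ᴳ K (suc t)) u v → u ∈ S ⊎ v ∈ S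
  covers = resolving-covers-nonadjacent (walk₂ hr ht) adjacent-sym resolving
  rows : ∀ a b c → b ≢ c → (a , b) ∈ S ⊎ (a , c) ∈ S
  rows a b c b≢c = covers (b≢c ∘ cong proj₂) same-row-nonadjacent
  columns : suc t * r ≤ length S
  columns = subst (_ ≤_) (length-map swap S) (rowCover-≤ (map swap S) λ b a c a≢c →
              Sum.map (∈-map⁺ swap) (∈-map⁺ swap) (covers (a≢c ∘ cong proj₁) same-column-nonadjacent))

module _ {r t : ℕ} (hr : 3 ≤ suc r) (ht : 3 ≤ suc t) where

  optimal-rows : suc r ≤ suc t → StrongResolvingSetOfSize (K (suc r) ×ᴳ K (suc t)) (suc r * t)
  optimal-rows r≤t = S , pairImage-unique (punctured ι) (punctured-injective ι) ,
                     resolving-if-complement-clique hr ht S complement-clique ,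
                     length-pairImage (punctured ι)
    where
    ι : Fin (suc r) → Fin (suc t)
    ι a = inject≤ a r≤t
    S : List (Fin (suc r) × Fin (suc t))
    S = pairImage (punctured ι)
    complement-clique : ∀ {u v} → u ∉ S → v ∉ S → u ≢ v → Adj (K (suc r) ×ᴳ K (suc t)) u v
    complement-clique {u} {v} u∉S v∉S u≢v =
      graph-adjacent (inject≤-injective r≤t r≤t _ _) u≢v
        (∉-punctured⇒graph ι u u∉S) (∉-punctured⇒graph ι v v∉S)

  optimal-columns : suc t ≤ suc r → StrongResolvingSetOfSize (K (suc r) ×ᴳ K (suc t)) (suc t * r)
  optimal-columns t≤r = S , map⁺ (cong swap) (pairImage-unique (punctured ι) (punctured-injective ι)) ,
                        resolving-if-complement-clique hr ht S complement-clique ,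
                        trans (length-map swap (pairImage (punctured ι))) (length-pairImage (punctured ι))
    where
    ι : Fin (suc t) → Fin (suc r)
    ι b = inject≤ b t≤r
    S : List (Fin (suc r) × Fin (suc t))
    S = map swap (pairImage (punctured ι))
    complement-clique : ∀ {u v} → u ∉ S → v ∉ S → u ≢ v → Adj (K (suc r) ×ᴳ K (suc t)) u v
    complement-clique {u} {v} u∉S v∉S u≢v =
      swap (graph-adjacent (inject≤-injective t≤r t≤r _ _) (u≢v ∘ cong swap)
             (∉-punctured⇒graph ι (swap u) (u∉S ∘ ∈-map⁺ swap))
             (∉-punctured⇒graph ι (swap v) (v∉S ∘ ∈-map⁺ swap)))

suc*≤suc* : ∀ {m n} → m ≤ n → suc n * m ≤ suc m * n
suc*≤suc* {m} {n} m≤n = +-mono-≤ m≤n (≤-reflexive (*-comm n m))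

proposition34 : ∀ (r t : ℕ) → 3 ≤ r → 3 ≤ t →
    StrongMetricDim (K r ×ᴳ K t) ((r * (t ∸ 1)) ⊔ (t * (r ∸ 1)))
proposition34 (suc r) (suc t) hr ht = optimal , λ _ _ → strongResolving-≥ hr ht
  where
  optimal : StrongResolvingSetOfSize (K (suc r) ×ᴳ K (suc t)) (suc r * t ⊔ suc t * r)
  optimal with ≤-total r t
  ... | inj₁ r≤t = subst (StrongResolvingSetOfSize _) (sym (m≥n⇒m⊔n≡m (suc*≤suc* r≤t)))
                         (optimal-rows hr ht (s≤s r≤t))
  ... | inj₂ t≤r = subst (StrongResolvingSetOfSize _) (sym (m≤n⇒m⊔n≡n (suc*≤suc* t≤r)))
                         (optimal-columns hr ht (s≤s t≤r))
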